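{- Run Algorithm T (as described in the context) on a finite directed graph to completion, and for each follower $v$ let $v.\mathit{lowarc}$ be its low arc. Then there is no directed cycle consisting of low arcs.
   Context: Loops and parallel arcs are allowed. Two vertices are mutually reachable if each is reachable from the other; the equivalence classes are the strong components. A depth-first exploration proceeds as follows. Initially all vertices are unvisited, all arcs untraversed, and the current vertex is null. Repeat the applicable case until all vertices are visited and all arcs are traversed: (i) The current vertex is null and some vertex is unvisited: choose any unvisited $v$, make it current and visit it; $v$ is a root. (ii) The current vertex $v$ has an untraversed exiting arc: choose any such arc $a$, from $v$ to $w$, and advance on it. If $w$ is visited, immediately retreat on $a$. Otherwise $a$ becomes a tree arc, $w$ becomes current and is visited. (iii) The current vertex $v$ has no untraversed exiting arc: if $v$ is a root, the current vertex becomes null; otherwise retreat on the tree arc entering $v$, from $u$ say, and make $u$ current. The first visit of $v$ is its previsit. The step (iii) at which $v$ is current with no untraversed exiting arc is its postvisit. Algorithm T does one depth-first exploration with a stack $F$ (initially empty): - Previsit of $v$: set $v.\mathit{pre}$ to the next integer $1,2,\dots$ and $v.\mathit{low}\gets v.\mathit{pre}$. - Retreat on any arc $a$ from $v$ to $w$: set $v.\mathit{low}\gets\min\{v.\mathit{low},w.\mathit{low}\}$. - Postvisit of $v$: - If $v.\mathit{low}\ne v.\mathit{pre}$, push $v$ on $F$. - Otherwise, pop from $F$ every top vertex $x$ with $x.\mathit{low}\ge v.\mathit{low}$, until $F$ is empty or its top has smaller low; set each popped $x.\mathit{low}\gets\infty$. Then set $v.\mathit{low}\gets\infty$. The leader of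 a strong component is its vertex of minimum $\mathit{pre}$; the other vertices are followers. For each follower $v$, the low arc $v.\mathit{lowarc}$ is the arc (exiting $v$) whose retreat caused the most recent decrease of $v.\mathit{low}$. Leaders have no low arc. -}

module Defs where

open import Data.Nat using (ℕ; zero; suc; _≤_; _<_)
open import Data.Nat.Properties using (_≤?_; _<?_)
open import Data.Fin using (Fin; _≟_)
open import Data.Bool using (Bool; true; false; if_then_else_)
open import Data.Maybe using (Maybe; just; nothing)
open import Data.List using (List; []; _∷_)
open import Data.Product using (_×_; _,_; ∃; proj₁; proj₂)
open import Relation.Nullary using (¬_; Dec; yes; no)
open import Relation.Nullary.Decidable using (⌊_⌋)
open import Relation.Binary.PropositionalEquality using (_≡_; _≢_)
open import Relation.Binary.Construct.Closure.ReflexiveTransitive using (Star)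
open import Relation.Binary.Construct.Closure.Transitive using (TransClosure)

record Digraph : Set where
  field
    n  : ℕ
    m  : ℕ
    tl : Fin m → Fin n
    hd : Fin m → Fin n

data Low : Set where
  fin : ℕ → Low
  ∞   : Low

_<L?_ : Low → Low → Bool
fin x <L? fin y = ⌊ x <? y ⌋
fin x <L? ∞     = true
∞     <L? _     = false

_≤L?_ : Low → Low → Bool
fin x ≤L? fin y = ⌊ x ≤? y ⌋
_     ≤L? ∞     = true
∞     ≤L? fin _ = false

_≡L?_ : Low → Low → Bool
fin x ≡L? fin y = ⌊ x Data.Nat.≟ y ⌋
fin _ ≡L? ∞     = false
∞     ≡L? fin _ = false
∞     ≡L? ∞     = true

upd : ∀ {k} {A : Set} → (Fin k → A) → Fin k → A → Fin k → A
upd f v x u = if ⌊ u ≟ v ⌋ then x else f u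

module AlgorithmT (G : Digraph) where
  open Digraph G

  -- State of Algorithm T during a depth-first exploration.
  --   cur    : current vertex (nothing = null)
  --   pre    : preorder number; 0 encodes "unvisited" (numbers start at 1)
  --   low    : the low values
  --   lowarc : the arc whose retreat caused the most recent decrease of low
  --   trav   : whether an arc has been traversed
  --   parent : the tree arc entering a vertex (nothing for roots/unvisited)
  --   F      : the stack F (head of the list = top)
  --   cnt    : the last preorder number handed out
  record State : Set where
    field
      cur    : Maybe (Fin n)
      pre    : Fin n → ℕ
      low    : Fin n → Low
      lowarc : Fin n → Maybe (Fin m)
      trav   : Fin m → Bool
      parent : Fin n → Maybe (Fin m)
      F      : List (Fin n)
      cnt    : ℕ
  open State public

  initial : State
  initial = record
    { cur = nothing ; pre = λ _ → 0 ; low = λ _ → ∞ ; lowarc = λ _ → nothing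
    ; trav = λ _ → false ; parent = λ _ → nothing ; F = [] ; cnt = 0 }

  Visited : State → Fin n → Set
  Visited s v = pre s v ≢ 0

  previsit : Fin n → State → State
  previsit w s = record s
    { cur = just w
    ; pre = upd (pre s) w (suc (cnt s))
    ; low = upd (low s) w (fin (suc (cnt s)))
    ; cnt = suc (cnt s) }

  retreat : Fin m → State → State
  retreat a s =
    if low s (hd a) <L? low s (tl a)
    then record s { low    = upd (low s) (tl a) (low s (hd a))
                  ; lowarc = upd (lowarc s) (tl a) (just a) }
    else s

  popF : Low → (Fin n → Low) → List (Fin n) → (Fin n → Low) × List (Fin n)
  popF l lw []       = lw , []
  popF l lw (x ∷ xs) =
    if l ≤L? lw x then popF l (upd lw x ∞) xs else (lw , x ∷ xs)

  postvisit : Fin n → State → State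
  postvisit v s =
    if low s v ≡L? fin (pre s v)
    then record s { low = upd (proj₁ (popF (low s v) (low s) (F s))) v ∞
                  ; F   = proj₂ (popF (low s v) (low s) (F s)) }
    else record s { F = v ∷ F s }

  data Step : State → State → Set where
    root : ∀ s v → cur s ≡ nothing → pre s v ≡ 0 → Step s (previsit v s)
    -- case (ii), w visited: advance and immediately retreat
    advance-visited : ∀ s v a → cur s ≡ just v → tl a ≡ v → trav s a ≡ false →
      Visited s (hd a) →
      Step s (retreat a (record s { trav = upd (trav s) a true }))
    advance-tree : ∀ s v a → cur s ≡ just v → tl a ≡ v → trav s a ≡ false →
      pre s (hd a) ≡ 0 →
      Step s (previsit (hd a) (record s { trav   = upd (trav s) a true
                                        ; parent = upd (parent s) (hd a) (just a) }))
    finish-root : ∀ s v → cur s ≡ just v →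
      (∀ a → tl a ≡ v → trav s a ≡ true) → parent s v ≡ nothing →
      Step s (record (postvisit v s) { cur = nothing })
    finish-child : ∀ s v a → cur s ≡ just v →
      (∀ b → tl b ≡ v → trav s b ≡ true) → parent s v ≡ just a →
      Step s (retreat a (record (postvisit v s) { cur = just (tl a) }))

  Complete : State → Set
  Complete s = cur s ≡ nothing × (∀ v → Visited s v) × (∀ a → trav s a ≡ true)

  Edge : Fin n → Fin n → Set
  Edge x y = ∃ λ a → tl a ≡ x × hd a ≡ y

  Reach : Fin n → Fin n → Set
  Reach = Star Edge

  Mutual : Fin n → Fin n → Set
  Mutual x y = Reach x y × Reach y x

  Leader : State → Fin n → Set
  Leader s v = ∀ u → Mutual v u → pre s v ≤ pre s u

  Follower : State → Fin n → Set
  Follower s v = ¬ Leader s v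

  LowArcStep : State → Fin n → Fin n → Set
  LowArcStep s x y =
    Follower s x × ∃ λ a → lowarc s x ≡ just a × tl a ≡ x × hd a ≡ y

  LowCycle : State → Set
  LowCycle s = ∃ λ v → TransClosure (LowArcStep s) v v

{-# OPTIONS --safe #-}
module Submission where

-- Stamp every vertex u that has a low arc with (k , t): the t-th decreasing
-- retreat set u.lowarc and lowered u.low to k. Along a low arc u → y the stamp
-- drops lexicographically. When u.lowarc was set, y.low was k, so either y's
-- low arc had already been set with value k at an earlier time, or y has none
-- and y.low stays k until it is reset to ∞. A later decrease of y.low happens
-- while y is on the recursion stack, where its low is finite, hence still at
-- most k; it drops below k and gives y a stamp (k′ , t′) with k′ < k. A cycle
-- of low arcs would therefore carry a stamp below itself.

open import Defs
open import Data.Bool using (true; false)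
open import Data.Empty using (⊥-elim)
open import Data.Fin using (Fin; _≟_)
open import Data.List using (List; []; _∷_; head)
open import Data.List.Membership.Propositional using (_∈_; _∉_)
open import Data.List.Relation.Unary.Any using (here; there)
open import Data.Maybe using (Maybe; just; nothing; map)
open import Data.Maybe.Properties using (just-injective)
open import Data.Nat using (ℕ; suc; _≤_; _<_)
open import Data.Nat.Properties using (_<?_; ≤-refl; ≤-reflexive; ≤-trans; <⇒≤; <-trans; <-irrefl; <-≤-trans; m≤n⇒m≤1+n; n<1+n)
open import Data.Product using (_×_; _,_; ∃; proj₁; proj₂)
open import Data.Product.Relation.Binary.Lex.Strict using (×-Lex; ×-transitive; ×-irreflexive)
open import Data.Sum using (_⊎_; inj₁; inj₂)
open import Data.Unit using (⊤; tt)
open import Function using (id; _∘_)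
open import Relation.Nullary using (¬_; yes; no)
open import Relation.Binary.PropositionalEquality
  using (_≡_; _≢_; refl; sym; trans; cong; subst; subst₂; isEquivalence; resp₂)
open import Relation.Binary.Construct.Closure.ReflexiveTransitive using (Star; ε; _◅_)
open import Relation.Binary.Construct.Closure.Transitive using (TransClosure; [_]; _∷_)

upd-same : ∀ {k} {A : Set} (f : Fin k → A) v x → upd f v x v ≡ x
upd-same f v x with v ≟ v
... | yes _ = refl
... | no v≢v = ⊥-elim (v≢v refl)

upd-other : ∀ {k} {A : Set} (f : Fin k → A) v x {u} → u ≢ v → upd f v x u ≡ f u
upd-other f v x {u} u≢v with u ≟ v
... | yes u≡v = ⊥-elim (u≢v u≡v)
... | no _ = refl

upd-cases : ∀ {k} {A : Set} (f : Fin k → A) v x u →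
            (u ≡ v × upd f v x u ≡ x) ⊎ (u ≢ v × upd f v x u ≡ f u)
upd-cases f v x u with u ≟ v
... | yes u≡v = inj₁ (u≡v , refl)
... | no u≢v  = inj₂ (u≢v , refl)

_⊑_ : Low → Low → Set
l′ ⊑ l = l′ ≡ l ⊎ l′ ≡ ∞

⊑-refl : ∀ {l} → l ⊑ l
⊑-refl = inj₁ refl

⊑-trans : ∀ {l″ l′ l} → l″ ⊑ l′ → l′ ⊑ l → l″ ⊑ l
⊑-trans (inj₁ refl) l′⊑l = l′⊑l
⊑-trans (inj₂ l″≡∞) _    = inj₂ l″≡∞

⊑∞⇒≡∞ : ∀ {l} → l ⊑ ∞ → l ≡ ∞
⊑∞⇒≡∞ (inj₁ l≡∞) = l≡∞
⊑∞⇒≡∞ (inj₂ l≡∞) = l≡∞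

upd-∞-⊑ : ∀ {k} (lw : Fin k → Low) x u → upd lw x ∞ u ⊑ lw u
upd-∞-⊑ lw x u with upd-cases lw x ∞ u
... | inj₁ (_ , reset) = inj₂ reset
... | inj₂ (_ , kept)  = inj₁ kept

fin-injective : ∀ {j k} → fin j ≡ fin k → j ≡ k
fin-injective refl = refl

fin-⊑-fin : ∀ {j k} → fin j ⊑ fin k → j ≡ k
fin-⊑-fin (inj₁ refl) = refl

<L?-fin : ∀ l k → (l <L? fin k) ≡ true → ∃ λ j → l ≡ fin j × j < k
<L?-fin (fin j) k _  with j <? k
... | yes j<k = j , refl , j<k
<L?-fin ∞       k ()

_<ₗₑₓ_ : ℕ × ℕ → ℕ × ℕ → Set
_<ₗₑₓ_ = ×-Lex _≡_ _<_ _<_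

<ₗₑₓ-trans : ∀ {p q r} → p <ₗₑₓ q → q <ₗₑₓ r → p <ₗₑₓ r
<ₗₑₓ-trans = ×-transitive {_≈₁_ = _≡_} {_<₁_ = _<_} {_<₂_ = _<_} isEquivalence (resp₂ _<_) <-trans <-trans

<ₗₑₓ-irrefl : ∀ {p} → ¬ p <ₗₑₓ p
<ₗₑₓ-irrefl = ×-irreflexive {_≈₁_ = _≡_} {_≈₂_ = _≡_} <-irrefl <-irrefl (refl , refl)

<ₗₑₓ⇒≤₁ : ∀ {p q} → p <ₗₑₓ q → proj₁ p ≤ proj₁ q
<ₗₑₓ⇒≤₁ (inj₁ p₁<q₁)         = <⇒≤ p₁<q₁
<ₗₑₓ⇒≤₁ (inj₂ (refl , _)) = ≤-refl

module _ (G : Digraph) where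
  open Digraph G
  open AlgorithmT G

  ParentChain : (Fin n → Maybe (Fin m)) → List (Fin n) → Set
  ParentChain par []      = ⊤
  ParentChain par (v ∷ p) = map tl (par v) ≡ head p × v ∉ p × ParentChain par p

  ParentChain-cong : ∀ {par par′} p → (∀ {u} → u ∈ p → par′ u ≡ par u) →
                     ParentChain par p → ParentChain par′ p
  ParentChain-cong []      _    _ = tt
  ParentChain-cong (v ∷ p) same (tail≡ , v∉p , chain) =
    trans (cong (map tl) (same (here refl))) tail≡ , v∉p ,
    ParentChain-cong p (λ u∈p → same (there u∈p)) chain

  head≡just : ∀ {v} (p : List (Fin n)) → head p ≡ just v → ∃ λ p′ → p ≡ v ∷ p′
  head≡just (v ∷ p′) refl = p′ , refl

  -- path is the recursion stack of the exploration: the vertices previsited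
  -- but not yet postvisited, the current vertex first.
  record PathInv (s : State) : Set where
    field
      path          : List (Fin n)
      cur≡head      : cur s ≡ head path
      chain         : ParentChain (parent s) path
      path-visited  : ∀ {u} → u ∈ path → Visited s u
      path-finite   : ∀ {u} → u ∈ path → ∃ λ k → low s u ≡ fin k
      F-visited     : ∀ {u} → u ∈ F s → Visited s u
      F-off-path    : ∀ {u} → u ∈ F s → u ∉ path
      unvisited     : ∀ {u} → pre s u ≡ 0 → low s u ≡ ∞ × parent s u ≡ nothing
  open PathInv

  current-on-path : ∀ {s v} (P : PathInv s) → cur s ≡ just v →
                    ∃ λ p′ → path P ≡ v ∷ p′
  current-on-path P cur≡v = head≡just (path P) (trans (sym (cur≡head P)) cur≡v)

  current∈path : ∀ {s v} (P : PathInv s) → cur s ≡ just v → v ∈ path P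
  current∈path P cur≡v with current-on-path P cur≡v
  ... | _ , path≡ = subst (_ ∈_) (sym path≡) (here refl)

  PathInv-initial : PathInv initial
  PathInv-initial = record
    { path = [] ; cur≡head = refl ; chain = tt
    ; path-visited = λ () ; path-finite = λ () ; F-visited = λ () ; F-off-path = λ ()
    ; unvisited = λ _ → refl , refl }

  PathInv-trav : ∀ {s} t → PathInv s → PathInv (record s { trav = t })
  PathInv-trav t P = record
    { path = path P ; cur≡head = cur≡head P ; chain = chain P
    ; path-visited = path-visited P ; path-finite = path-finite P
    ; F-visited = F-visited P ; F-off-path = F-off-path P ; unvisited = unvisited P }

  visited-≢ : ∀ s {u w} → Visited s u → pre s w ≡ 0 → u ≢ w
  visited-≢ _ u-visited w-unvisited refl = u-visited w-unvisited

  Visited-previsit : ∀ s {u} w par t → pre s w ≡ 0 → Visited s u →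
                     Visited (previsit w (record s { trav = t ; parent = par })) u
  Visited-previsit s w _ _ w-unvisited u-visited =
    subst (λ k → k ≢ 0) (sym (upd-other (pre s) w _ (visited-≢ s u-visited w-unvisited))) u-visited

  PathInv-previsit : ∀ {s} w (par : Fin n → Maybe (Fin m)) t → PathInv s → pre s w ≡ 0 →
                     (∀ {u} → u ≢ w → par u ≡ parent s u) → map tl (par w) ≡ cur s →
                     PathInv (previsit w (record s { trav = t ; parent = par }))
  PathInv-previsit {s} w par t P w-unvisited par-other par-w = record
    { path = w ∷ path P
    ; cur≡head = refl
    ; chain = trans par-w (cur≡head P) , (λ w∈ → ≢w (path-visited P w∈) refl) ,
              ParentChain-cong (path P) (λ u∈ → par-other (≢w (path-visited P u∈))) (chain P)
    ; path-visited = visited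
    ; path-finite = finite
    ; F-visited = λ u∈F → stays-visited (F-visited P u∈F)
    ; F-off-path = off-path
    ; unvisited = still-unvisited }
    where
    c = suc (cnt s)
    s′ = previsit w (record s { trav = t ; parent = par })
    ≢w : ∀ {u} → Visited s u → u ≢ w
    ≢w u-visited = visited-≢ s u-visited w-unvisited
    stays-visited : ∀ {u} → Visited s u → Visited s′ u
    stays-visited = Visited-previsit s w par t w-unvisited
    visited : ∀ {u} → u ∈ w ∷ path P → Visited s′ u
    visited (here refl) = subst (λ k → k ≢ 0) (sym (upd-same (pre s) w c)) (λ ())
    visited (there u∈) = stays-visited (path-visited P u∈)
    finite : ∀ {u} → u ∈ w ∷ path P → ∃ λ k → low s′ u ≡ fin k
    finite (here refl) = c , upd-same (low s) w (fin c)
    finite (there u∈) with path-finite P u∈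
    ... | k , low≡k = k , trans (upd-other (low s) w (fin c) (≢w (path-visited P u∈))) low≡k
    off-path : ∀ {u} → u ∈ F s → u ∉ w ∷ path P
    off-path u∈F (here refl) = ≢w (F-visited P u∈F) refl
    off-path u∈F (there u∈) = F-off-path P u∈F u∈
    still-unvisited : ∀ {u} → pre s′ u ≡ 0 → low s′ u ≡ ∞ × par u ≡ nothing
    still-unvisited {u} pre≡0 =
      trans (upd-other (low s) w (fin c) u≢w) (proj₁ was-unvisited) ,
      trans (par-other u≢w) (proj₂ was-unvisited)
      where
      u≢w : u ≢ w
      u≢w refl = visited (here refl) pre≡0
      was-unvisited = unvisited P (trans (sym (upd-other (pre s) w c u≢w)) pre≡0)

  lowered : Fin m → State → State
  lowered a s = record s { low    = upd (low s) (tl a) (low s (hd a))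
                         ; lowarc = upd (lowarc s) (tl a) (just a) }

  record Lowering (s : State) (a : Fin m) : Set where
    field
      {i j}  : ℕ
      tl-low : low s (tl a) ≡ fin i
      hd-low : low s (hd a) ≡ fin j
      j<i    : j < i
  open Lowering

  retreat-cases : ∀ {s} a → PathInv s → cur s ≡ just (tl a) →
                  retreat a s ≡ s ⊎ (Lowering s a × retreat a s ≡ lowered a s)
  retreat-cases {s} a P cur≡x with low s (hd a) <L? low s (tl a) in lt
  ... | false = inj₁ refl
  ... | true with path-finite P (current∈path P cur≡x)
  ...   | i , tl-low with <L?-fin (low s (hd a)) i (subst (λ l → (low s (hd a) <L? l) ≡ true) tl-low lt)
  ...     | j , hd-low , j<i = inj₂ (record { tl-low = tl-low ; hd-low = hd-low ; j<i = j<i } , refl)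

  PathInv-lowered : ∀ {s} a → PathInv s → Visited s (tl a) → Lowering s a →
                    PathInv (lowered a s)
  PathInv-lowered {s} a P x-visited L = record
    { path = path P ; cur≡head = cur≡head P ; chain = chain P
    ; path-visited = path-visited P ; path-finite = finite
    ; F-visited = F-visited P ; F-off-path = F-off-path P ; unvisited = still-unvisited }
    where
    s′ = lowered a s
    finite : ∀ {u} → u ∈ path P → ∃ λ k → low s′ u ≡ fin k
    finite {u} u∈ with upd-cases (low s) (tl a) (low s (hd a)) u
    ... | inj₁ (_ , low′≡) = j L , trans low′≡ (hd-low L)
    ... | inj₂ (_ , low′≡) with path-finite P u∈
    ...   | k , low≡k = k , trans low′≡ low≡k
    still-unvisited : ∀ {u} → pre s u ≡ 0 → low s′ u ≡ ∞ × parent s u ≡ nothing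
    still-unvisited {u} pre≡0 =
      trans (upd-other (low s) (tl a) (low s (hd a)) u≢x) (proj₁ (unvisited P pre≡0)) ,
      proj₂ (unvisited P pre≡0)
      where
      u≢x : u ≢ tl a
      u≢x refl = x-visited pre≡0

  PathInv-retreat : ∀ {s} a → PathInv s → cur s ≡ just (tl a) → PathInv (retreat a s)
  PathInv-retreat a P cur≡x with retreat-cases a P cur≡x
  ... | inj₁ unchanged      = subst PathInv (sym unchanged) P
  ... | inj₂ (L , lowers) =
    subst PathInv (sym lowers) (PathInv-lowered a P (path-visited P (current∈path P cur≡x)) L)

  popF-⊑ : ∀ l lw xs u → proj₁ (popF l lw xs) u ⊑ lw u
  popF-⊑ l lw []       u = ⊑-refl
  popF-⊑ l lw (x ∷ xs) u with l ≤L? lw x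
  ... | false = ⊑-refl
  ... | true  = ⊑-trans (popF-⊑ l (upd lw x ∞) xs u) (upd-∞-⊑ lw x u)

  popF-keeps : ∀ l lw xs {u} → u ∉ xs → proj₁ (popF l lw xs) u ≡ lw u
  popF-keeps l lw []       u∉ = refl
  popF-keeps l lw (x ∷ xs) u∉ with l ≤L? lw x
  ... | false = refl
  ... | true  = trans (popF-keeps l (upd lw x ∞) xs (λ u∈ → u∉ (there u∈)))
                      (upd-other lw x ∞ (λ u≡x → u∉ (here u≡x)))

  popF-⊆ : ∀ l lw xs {u} → u ∈ proj₂ (popF l lw xs) → u ∈ xs
  popF-⊆ l lw []       ()
  popF-⊆ l lw (x ∷ xs) u∈ with l ≤L? lw x
  ... | false = u∈
  ... | true  = there (popF-⊆ l (upd lw x ∞) xs u∈)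

  record PostvisitEffect (v : Fin n) (s s′ : State) : Set where
    field
      low′  : Fin n → Low
      F′    : List (Fin n)
      shape : s′ ≡ record s { low = low′ ; F = F′ }
      reset : ∀ u → low′ u ⊑ low s u
      keeps : ∀ {u} → u ≢ v → u ∉ F s → low′ u ≡ low s u
      F′⊆   : ∀ {u} → u ∈ F′ → u ≡ v ⊎ u ∈ F s
  open PostvisitEffect

  postvisit-effect : ∀ v s → PostvisitEffect v s (postvisit v s)
  postvisit-effect v s with low s v ≡L? fin (pre s v)
  ... | true = record
    { low′ = upd (proj₁ popped) v ∞ ; F′ = proj₂ popped ; shape = refl
    ; reset = λ u → ⊑-trans (upd-∞-⊑ (proj₁ popped) v u) (popF-⊑ (low s v) (low s) (F s) u)
    ; keeps = λ u≢v u∉F → trans (upd-other (proj₁ popped) v ∞ u≢v) (popF-keeps (low s v) (low s) (F s) u∉F)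
    ; F′⊆ = λ u∈ → inj₂ (popF-⊆ (low s v) (low s) (F s) u∈) }
    where popped = popF (low s v) (low s) (F s)
  ... | false = record
    { low′ = low s ; F′ = v ∷ F s ; shape = refl
    ; reset = λ _ → ⊑-refl ; keeps = λ _ _ → refl
    ; F′⊆ = λ { (here u≡v) → inj₁ u≡v ; (there u∈F) → inj₂ u∈F } }

  PathInv-postvisit : ∀ {s v} X → PathInv s → cur s ≡ just v → X ≡ map tl (parent s v) →
                      PathInv (record (postvisit v s) { cur = X })
  PathInv-postvisit {s} {v} X P cur≡v X≡ with current-on-path P cur≡v
  ... | p′ , path≡ with subst (ParentChain (parent s)) path≡ (chain P)
  ...   | tail≡ , v∉p′ , chain′ =
    subst (λ s′ → PathInv (record s′ { cur = X })) (sym (shape E)) (record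
      { path = p′
      ; cur≡head = trans X≡ tail≡
      ; chain = chain′
      ; path-visited = λ u∈ → path-visited P (on-path (there u∈))
      ; path-finite = finite
      ; F-visited = F-visited′
      ; F-off-path = off-path
      ; unvisited = λ {u} pre≡0 →
          ⊑∞⇒≡∞ (subst (low′ E u ⊑_) (proj₁ (unvisited P pre≡0)) (reset E u)) ,
          proj₂ (unvisited P pre≡0) })
    where
    E = postvisit-effect v s
    on-path : ∀ {u} → u ∈ v ∷ p′ → u ∈ path P
    on-path u∈ = subst (_ ∈_) (sym path≡) u∈
    finite : ∀ {u} → u ∈ p′ → ∃ λ k → low′ E u ≡ fin k
    finite u∈ with path-finite P (on-path (there u∈))
    ... | k , low≡k =
      k , trans (keeps E (λ { refl → v∉p′ u∈ }) (λ u∈F → F-off-path P u∈F (on-path (there u∈)))) low≡k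
    F-visited′ : ∀ {u} → u ∈ F′ E → Visited s u
    F-visited′ u∈ with F′⊆ E u∈
    ... | inj₁ refl = path-visited P (on-path (here refl))
    ... | inj₂ u∈F  = F-visited P u∈F
    off-path : ∀ {u} → u ∈ F′ E → u ∉ p′
    off-path u∈ with F′⊆ E u∈
    ... | inj₁ refl = v∉p′
    ... | inj₂ u∈F  = λ u∈p′ → F-off-path P u∈F (on-path (there u∈p′))

  -- The condition along a low arc u → y: either y has a low arc itself and a
  -- smaller stamp, or y.low is still the value u copied from it (or was reset).
  Descent : Maybe (Fin m) → Low → ℕ × ℕ → ℕ × ℕ → Set
  Descent (just _) _  σy σu = σy <ₗₑₓ σu
  Descent nothing  ly _  σu = ly ⊑ fin (proj₁ σu)

  Descent-cong : ∀ {mb mb′ l l′ σy σy′ σu σu′} → mb′ ≡ mb → l′ ≡ l → σy′ ≡ σy → σu′ ≡ σu →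
                 Descent mb l σy σu → Descent mb′ l′ σy′ σu′
  Descent-cong refl refl refl refl d = d

  Descent-⊑ : ∀ mb {l′ l σy σu} → l′ ⊑ l → Descent mb l σy σu → Descent mb l′ σy σu
  Descent-⊑ (just _) _     d = d
  Descent-⊑ nothing  l′⊑l d = ⊑-trans l′⊑l d

  record LowArcSound (s : State) (stamp : Fin n → ℕ × ℕ) (clock : ℕ) (u y : Fin n) : Set where
    field
      tail-visited : Visited s u
      head-visited : Visited s y
      low-stamped  : low s u ⊑ fin (proj₁ (stamp u))
      stamp-past   : proj₂ (stamp u) < clock
      descent      : Descent (lowarc s y) (low s y) (stamp y) (stamp u)
  open LowArcSound

  record LowArcInv (s : State) : Set where
    field
      stamp : Fin n → ℕ × ℕ
      clock : ℕ
      sound : ∀ {u a} → lowarc s u ≡ just a → LowArcSound s stamp clock u (hd a)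
  open LowArcInv

  LowArcInv-initial : LowArcInv initial
  LowArcInv-initial = record { stamp = λ _ → 0 , 0 ; clock = 0 ; sound = λ () }

  LowArcInv-reset : ∀ {s s′} → LowArcInv s →
                    (∀ u → lowarc s′ u ≡ lowarc s u) → (∀ {u} → Visited s u → Visited s′ u) →
                    (∀ {u} → Visited s u → low s′ u ⊑ low s u) → LowArcInv s′
  LowArcInv-reset {s} {s′} J same-arc stays-visited resets = record
    { stamp = stamp J ; clock = clock J ; sound = sound′ }
    where
    sound′ : ∀ {u a} → lowarc s′ u ≡ just a → LowArcSound s′ (stamp J) (clock J) u (hd a)
    sound′ {u} {a} arc = record
      { tail-visited = stays-visited (tail-visited S)
      ; head-visited = stays-visited (head-visited S)
      ; low-stamped  = ⊑-trans (resets (tail-visited S)) (low-stamped S)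
      ; stamp-past   = stamp-past S
      ; descent      = Descent-cong (same-arc (hd a)) refl refl refl
                         (Descent-⊑ (lowarc s (hd a)) (resets (head-visited S)) (descent S)) }
      where S = sound J (trans (sym (same-arc u)) arc)

  LowArcInv-trav : ∀ {s} t → LowArcInv s → LowArcInv (record s { trav = t })
  LowArcInv-trav t J = LowArcInv-reset J (λ _ → refl) id (λ _ → ⊑-refl)

  LowArcInv-previsit : ∀ {s} w (par : Fin n → Maybe (Fin m)) t → LowArcInv s → pre s w ≡ 0 →
                       LowArcInv (previsit w (record s { trav = t ; parent = par }))
  LowArcInv-previsit {s} w par t J w-unvisited = LowArcInv-reset J (λ _ → refl)
    (Visited-previsit s w par t w-unvisited)
    (λ u-visited → inj₁ (upd-other (low s) w _ (visited-≢ s u-visited w-unvisited)))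

  LowArcInv-postvisit : ∀ {s v} X → LowArcInv s → LowArcInv (record (postvisit v s) { cur = X })
  LowArcInv-postvisit {s} {v} X J =
    subst (λ s′ → LowArcInv (record s′ { cur = X })) (sym (shape E))
      (LowArcInv-reset J (λ _ → refl) id (λ {u} _ → reset E u))
    where E = postvisit-effect v s

  descent-bound : ∀ {s} (J : LowArcInv s) {x u i} → low s x ≡ fin i →
                  Descent (lowarc s x) (low s x) (stamp J x) (stamp J u) → i ≤ proj₁ (stamp J u)
  descent-bound {s} J {x} low≡i d with lowarc s x in arc
  ... | just _  = ≤-trans (≤-reflexive (fin-⊑-fin (subst (_⊑ _) low≡i (low-stamped (sound J arc)))))
                          (<ₗₑₓ⇒≤₁ d)
  ... | nothing = ≤-reflexive (fin-⊑-fin (subst (_⊑ _) low≡i d))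

  descent-to-fresh : ∀ {s} (J : LowArcInv s) {y j} → low s y ≡ fin j →
                     Descent (lowarc s y) (low s y) (stamp J y) (j , clock J)
  descent-to-fresh {s} J {y} low≡j with lowarc s y in arc
  ... | just _  = inj₂ (sym (fin-⊑-fin (subst (_⊑ _) low≡j (low-stamped S))) , stamp-past S)
    where S = sound J arc
  ... | nothing = inj₁ low≡j

  -- The key step: the new stamp (j , clock) of x is below the stamp of every
  -- u whose low arc enters x, since those satisfy i ≤ proj₁ (stamp u).
  LowArcInv-lowered : ∀ {s} a → LowArcInv s → Visited s (tl a) → Visited s (hd a) →
                      Lowering s a → LowArcInv (lowered a s)
  LowArcInv-lowered {s} a J x-visited y-visited L = record
    { stamp = stamp′ ; clock = suc (clock J) ; sound = sound′ }
    where
    x = tl a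
    y = hd a
    s′ = lowered a s
    stamp′ = upd (stamp J) x (j L , clock J)

    stamp′-x : stamp′ x ≡ (j L , clock J)
    stamp′-x = upd-same (stamp J) x (j L , clock J)

    y≢x : y ≢ x
    y≢x y≡x = <-irrefl (fin-injective (trans (sym (hd-low L)) (trans (cong (low s) y≡x) (tl-low L)))) (j<i L)

    new-arc : LowArcSound s′ stamp′ (suc (clock J)) x y
    new-arc = record
      { tail-visited = x-visited
      ; head-visited = y-visited
      ; low-stamped  = inj₁ (trans (trans (upd-same (low s) x (low s y)) (hd-low L))
                                   (sym (cong (fin ∘ proj₁) stamp′-x)))
      ; stamp-past   = subst (λ σ → proj₂ σ < suc (clock J)) (sym stamp′-x) (n<1+n (clock J))
      ; descent      = Descent-cong (upd-other (lowarc s) x (just a) y≢x) (upd-other (low s) x (low s y) y≢x)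
                         (upd-other (stamp J) x _ y≢x) stamp′-x (descent-to-fresh J (hd-low L)) }

    old-arc : ∀ {u c} → u ≢ x → lowarc s u ≡ just c → LowArcSound s′ stamp′ (suc (clock J)) u (hd c)
    old-arc {u} {c} u≢x arc = record
      { tail-visited = tail-visited S
      ; head-visited = head-visited S
      ; low-stamped  = subst₂ _⊑_ (sym (upd-other (low s) x (low s y) u≢x))
                         (cong (fin ∘ proj₁) (sym stamp′-u)) (low-stamped S)
      ; stamp-past   = subst (λ σ → proj₂ σ < suc (clock J)) (sym stamp′-u) (m≤n⇒m≤1+n (stamp-past S))
      ; descent      = descent′ }
      where
      S = sound J arc
      stamp′-u : stamp′ u ≡ stamp J u
      stamp′-u = upd-other (stamp J) x _ u≢x
      descent′ : Descent (lowarc s′ (hd c)) (low s′ (hd c)) (stamp′ (hd c)) (stamp′ u)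
      descent′ with upd-cases (lowarc s) x (just a) (hd c)
      ... | inj₂ (z≢x , arc′) = Descent-cong arc′ (upd-other (low s) x (low s y) z≢x)
                                  (upd-other (stamp J) x _ z≢x) stamp′-u (descent S)
      ... | inj₁ (z≡x , arc′) = Descent-cong arc′ refl (trans (cong stamp′ z≡x) stamp′-x) stamp′-u
                                  (inj₁ (<-≤-trans (j<i L) (descent-bound J (tl-low L) descent-x)))
        where
        descent-x : Descent (lowarc s x) (low s x) (stamp J x) (stamp J u)
        descent-x = subst (λ z → Descent (lowarc s z) (low s z) (stamp J z) (stamp J u)) z≡x (descent S)

    sound′ : ∀ {u c} → lowarc s′ u ≡ just c → LowArcSound s′ stamp′ (suc (clock J)) u (hd c)
    sound′ {u} arc with upd-cases (lowarc s) x (just a) u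
    ... | inj₁ (refl , arc′) with just-injective (trans (sym arc′) arc)
    ...   | refl = new-arc
    sound′ arc | inj₂ (u≢x , arc′) = old-arc u≢x (trans (sym arc′) arc)

  LowArcInv-retreat : ∀ {s} a → PathInv s → LowArcInv s → cur s ≡ just (tl a) →
                      LowArcInv (retreat a s)
  LowArcInv-retreat {s} a P J cur≡x with retreat-cases a P cur≡x
  ... | inj₁ unchanged    = subst LowArcInv (sym unchanged) J
  ... | inj₂ (L , lowers) = subst LowArcInv (sym lowers)
    (LowArcInv-lowered a J (path-visited P (current∈path P cur≡x)) y-visited L)
    where
    y-visited : Visited s (hd a)
    y-visited pre≡0 with trans (sym (hd-low L)) (proj₁ (unvisited P pre≡0))
    ... | ()

  Invariant : State → Set
  Invariant s = PathInv s × LowArcInv s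

  Invariant-step : ∀ {s s′} → Invariant s → Step s s′ → Invariant s′
  Invariant-step (P , J) (root s v cur≡nothing v-unvisited) =
    PathInv-previsit v (parent s) (trav s) P v-unvisited (λ _ → refl)
      (trans (cong (map tl) (proj₂ (unvisited P v-unvisited))) (sym cur≡nothing)) ,
    LowArcInv-previsit v (parent s) (trav s) J v-unvisited
  Invariant-step (P , J) (advance-visited s v a cur≡v tl≡v _ _) =
    PathInv-retreat a P′ cur≡x , LowArcInv-retreat a P′ (LowArcInv-trav t J) cur≡x
    where
    t = upd (trav s) a true
    P′ = PathInv-trav t P
    cur≡x = trans cur≡v (cong just (sym tl≡v))
  Invariant-step (P , J) (advance-tree s v a cur≡v tl≡v _ w-unvisited) =
    PathInv-previsit (hd a) par t P w-unvisited (upd-other (parent s) (hd a) (just a))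
      (trans (cong (map tl) (upd-same (parent s) (hd a) (just a))) (trans (cong just tl≡v) (sym cur≡v))) ,
    LowArcInv-previsit (hd a) par t J w-unvisited
    where
    t = upd (trav s) a true
    par = upd (parent s) (hd a) (just a)
  Invariant-step (P , J) (finish-root s v cur≡v _ parent≡nothing) =
    PathInv-postvisit nothing P cur≡v (sym (cong (map tl) parent≡nothing)) ,
    LowArcInv-postvisit nothing J
  Invariant-step (P , J) (finish-child s v a cur≡v _ parent≡a) =
    PathInv-retreat a P′ refl , LowArcInv-retreat a P′ (LowArcInv-postvisit _ J) refl
    where P′ = PathInv-postvisit (just (tl a)) P cur≡v (sym (cong (map tl) parent≡a))

  Invariant-reachable : ∀ {s} → Star Step initial s → Invariant s
  Invariant-reachable = go (PathInv-initial , LowArcInv-initial)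
    where
    go : ∀ {s s′} → Invariant s → Star Step s s′ → Invariant s′
    go I ε            = I
    go I (step ◅ run) = go (Invariant-step I step) run

  has-lowarc : ∀ {s x y} → TransClosure (LowArcStep s) x y → ∃ λ b → lowarc s x ≡ just b
  has-lowarc [ _ , a , arc , _ ]     = a , arc
  has-lowarc ((_ , a , arc , _) ∷ _) = a , arc

  module _ {s : State} (J : LowArcInv s) where
    stamp-descends : ∀ {x y b} → LowArcStep s x y → lowarc s y ≡ just b →
                     stamp J y <ₗₑₓ stamp J x
    stamp-descends (_ , a , arc , _ , refl) y-arc =
      Descent-cong (sym y-arc) refl refl refl (descent (sound J arc))

    stamps-descend : ∀ {x y b} → TransClosure (LowArcStep s) x y → lowarc s y ≡ just b →
                     stamp J y <ₗₑₓ stamp J x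
    stamps-descend [ step ]       y-arc = stamp-descends step y-arc
    stamps-descend (step ∷ steps) y-arc =
      <ₗₑₓ-trans (stamps-descend steps y-arc) (stamp-descends step (proj₂ (has-lowarc {s} steps)))

    no-low-cycle : ¬ LowCycle s
    no-low-cycle (_ , cycle) = <ₗₑₓ-irrefl (stamps-descend cycle (proj₂ (has-lowarc {s} cycle)))

lemma15 : (G : Digraph) (s : AlgorithmT.State G) →
          Star (AlgorithmT.Step G) (AlgorithmT.initial G) s →
          AlgorithmT.Complete G s →
          ¬ AlgorithmT.LowCycle G s
lemma15 G s run _ = no-low-cycle G (proj₂ (Invariant-reachable G run))
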